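{- For every graph $G$, $V(G)$ is the disjoint union $\mathrm{corona}(G)\,\dot\cup\,N_G(\mathrm{core}(G))$ if and only if $L^c(G)$ is the disjoint union $\mathrm{corona}(L_G^c)\,\dot\cup\,N_{L_G^c}(\mathrm{core}(L_G^c))$.
   Context: All graphs are finite, simple and undirected. $\alpha(H)$ is the maximum size of an independent set of $H$; $\Omega(H)$ is the family of maximum independent sets of $H$; $\mathrm{core}(H)=\bigcap_{S\in\Omega(H)}S$ and $\mathrm{corona}(H)=\bigcup_{S\in\Omega(H)}S$ (for the graph with no vertices, core and corona are empty). For a graph $H$ and $S\subseteq V(H)$, $N_H(S)$ is the set of vertices of $H$ adjacent in $H$ to some vertex of $S$; $N=N_G$. An independent set $I$ of $G$ is critical if $|I|-|N(I)|=\max\{|J|-|N(J)|:J\subseteq V(G)\}$; a maximum critical independent set is a critical independent set of maximum cardinality. Larson's set $L(G)$ is defined as $L(G)=J\cup N(J)$ for a maximum critical independent set $J$ of $G$ (this is known to be independent of the choice of $J$). Let $L^c(G)=V(G)\setminus L(G)$, $L_G=G[L(G)]$ and $L_G^c=G[L^c(G)]$. -}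

module Defs where

open import Data.Nat using (ℕ; zero; suc; _≤_)
open import Data.Bool using (Bool; true; false; _∧_; _∨_)
open import Data.Fin using (Fin; zero; suc)
open import Data.Fin.Subset using (Subset; _∈_; _⊆_; ∣_∣)
open import Data.Vec using (Vec; tabulate; lookup)
open import Data.Integer as ℤ using (ℤ; +_)
open import Data.Product using (Σ; ∃; ∃-syntax; _×_)
open import Data.Sum using (_⊎_)
open import Data.Empty using (⊥)
open import Relation.Nullary using (¬_)
open import Relation.Binary.PropositionalEquality using (_≡_)
open import Function.Bundles using (_⇔_)

record Graph (n : ℕ) : Set where
  field
    adj    : Fin n → Fin n → Bool
    sym    : ∀ x y → adj x y ≡ adj y x
    irrefl : ∀ x → adj x x ≡ false
open Graph public

Adjacent : ∀ {n} → Graph n → Fin n → Fin n → Set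
Adjacent G x y = adj G x y ≡ true

anyFin : ∀ {n} → (Fin n → Bool) → Bool
anyFin {zero}  f = false
anyFin {suc n} f = f zero ∨ anyFin (λ i → f (suc i))

nbhd : ∀ {n} → Graph n → Subset n → Subset n
nbhd G S = tabulate (λ x → anyFin (λ y → lookup S y ∧ adj G x y))

Independent : ∀ {n} → Graph n → Subset n → Set
Independent G S = ∀ x y → x ∈ S → y ∈ S → ¬ Adjacent G x y

-- Notions for the induced subgraph H = G[W], W ⊆ V(G), expressed
-- relative to W (no reindexing of vertices).

IndepIn : ∀ {n} → Graph n → Subset n → Subset n → Set
IndepIn G W S = S ⊆ W × Independent G S

MaxIndepIn : ∀ {n} → Graph n → Subset n → Subset n → Set
MaxIndepIn G W S = IndepIn G W S × (∀ T → IndepIn G W T → ∣ T ∣ ≤ ∣ S ∣)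

InCore : ∀ {n} → Graph n → Subset n → Fin n → Set
InCore G W x = ∀ S → MaxIndepIn G W S → x ∈ S

InCorona : ∀ {n} → Graph n → Subset n → Fin n → Set
InCorona G W x = ∃[ S ] (MaxIndepIn G W S × x ∈ S)

InNbrIn : ∀ {n} → Graph n → Subset n → (Fin n → Set) → Fin n → Set
InNbrIn G W P x = x ∈ W × ∃[ y ] (y ∈ W × P y × Adjacent G x y)

CoronaNCoreDecomp : ∀ {n} → Graph n → Subset n → Set
CoronaNCoreDecomp G W =
  (∀ x → (x ∈ W ⇔ (InCorona G W x ⊎ InNbrIn G W (InCore G W) x)))
  × (∀ x → InCorona G W x → InNbrIn G W (InCore G W) x → ⊥)

defect : ∀ {n} → Graph n → Subset n → ℤ
defect G S = (+ ∣ S ∣) ℤ.- (+ ∣ nbhd G S ∣)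

CriticalIndep : ∀ {n} → Graph n → Subset n → Set
CriticalIndep {n} G I = Independent G I × (∀ (J : Subset n) → defect G J ℤ.≤ defect G I)

MaxCriticalIndep : ∀ {n} → Graph n → Subset n → Set
MaxCriticalIndep G I = CriticalIndep G I × (∀ I′ → CriticalIndep G I′ → ∣ I′ ∣ ≤ ∣ I ∣)

{-# OPTIONS --safe #-}
module Submission where

-- For A ⊆ N(J), comparing the defect of the critical set J with that of J ∖ N(A) gives Hall's
-- condition |A| ≤ |J ∩ N(A)|.  Hence every independent set S has |S ∩ (J ∪ N(J))| ≤ |J|, so for
-- W = L^c(G) the maps S ↦ S ∩ W and T ↦ J ∪ T carry maximum independent sets of G and of G[W]
-- to each other; in particular core(G[W]) = core(G) ∩ W and core(G) misses N(J).  This settles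
-- every vertex outside N(J).  A vertex x ∈ N(J) lies in corona(G) ∪ N(core(G)) in any case: for
-- a maximum independent set S, A = S ∩ N(J) is tight (|J ∩ N(A)| = |A|) and dominates J ∖ S, and
-- tight sets are closed under union.  If x were outside corona(G) with no neighbour in core(G),
-- the largest tight set U avoiding x would dominate every neighbour of x in J, and U ∪ {x} would
-- violate Hall's condition.

open import Defs
open import Data.Fin.Subset using (Subset; ⊤; ∁; _∪_)
open import Function.Bundles using (_⇔_)

open import Data.Bool using (Bool; true; false; _∧_; _∨_)
open import Data.Bool.Properties using (∨-zeroʳ) renaming (_≟_ to _≟ᵇ_)
open import Data.Empty using (⊥; ⊥-elim)
open import Data.Fin using (Fin; zero; suc)
open import Data.Fin.Properties using (any?; all?)
open import Data.Fin.Subset using (_∩_; _∈_; _∉_; _⊆_; ∣_∣; ⁅_⁆; inside; outside) renaming (⊥ to ∅)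
open import Data.Fin.Subset.Properties
  using ( _∈?_; _⊆?_; anySubset?; ∈⊤; ∉⊥; ⊥⊆; ∣⊥∣≡0; ∣p∣≤n; x∈⁅x⁆; x∈⁅y⁆⇒x≡y
        ; p⊆q⇒∣p∣≤∣q∣; p⊂q⇒∣p∣<∣q∣; p∩q⊆p; p∩q⊆q; x∈p∩q⁺; x∈p∩q⁻
        ; p⊆p∪q; q⊆p∪q; x∈p∪q⁺; x∈p∪q⁻; x∈∁p⇒x∉p; x∉p⇒x∈∁p; ∩-distribˡ-∪ )
import Data.Integer as ℤ
import Data.Integer.Properties as ℤ
open import Data.Integer.Tactic.RingSolver using (solve-∀)
open import Data.Nat using (zero; suc; _+_; _≤_; _<_)
open import Data.Nat.Properties
open import Data.Product using (∃; _×_; _,_; proj₁; proj₂)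
open import Data.Sum using (_⊎_; inj₁; inj₂; [_,_])
open import Data.Vec using ([]; _∷_; lookup)
open import Data.Vec.Properties using (lookup∘tabulate; []=⇒lookup; lookup⇒[]=)
open import Function using (_∘_; id)
open import Function.Bundles using (mk⇔; Equivalence)
open import Relation.Nullary using (¬_; yes; no)
open import Relation.Nullary.Decidable using (_×-dec_; _→-dec_; ¬?; decidable-stable)
open import Relation.Unary using (Decidable)
open import Relation.Binary.PropositionalEquality
  using (_≡_; refl; trans; cong; subst) renaming (sym to ≡-sym)

m-n≤o-p⇒m+p≤o+n : ∀ m n o p → ℤ.+ m ℤ.- ℤ.+ n ℤ.≤ ℤ.+ o ℤ.- ℤ.+ p → m + p ≤ o + n
m-n≤o-p⇒m+p≤o+n m n o p le = ℤ.drop‿+≤+ (begin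
  ℤ.+ (m + p)                               ≡⟨ ≡-sym (cancelˡ (ℤ.+ m) (ℤ.+ n) (ℤ.+ p)) ⟩
  (ℤ.+ m ℤ.- ℤ.+ n) ℤ.+ (ℤ.+ n ℤ.+ ℤ.+ p)  ≤⟨ ℤ.+-monoˡ-≤ (ℤ.+ n ℤ.+ ℤ.+ p) le ⟩
  (ℤ.+ o ℤ.- ℤ.+ p) ℤ.+ (ℤ.+ n ℤ.+ ℤ.+ p)  ≡⟨ cancelʳ (ℤ.+ o) (ℤ.+ p) (ℤ.+ n) ⟩
  ℤ.+ (o + n)                               ∎)
  where
  open ℤ.≤-Reasoning
  cancelˡ : ∀ a b c → (a ℤ.- b) ℤ.+ (b ℤ.+ c) ≡ a ℤ.+ c
  cancelˡ = solve-∀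
  cancelʳ : ∀ a c b → (a ℤ.- c) ℤ.+ (b ℤ.+ c) ≡ a ℤ.+ b
  cancelʳ = solve-∀

∣p∩q∣+∣p∩∁q∣≡∣p∣ : ∀ {n} (p q : Subset n) → ∣ p ∩ q ∣ + ∣ p ∩ ∁ q ∣ ≡ ∣ p ∣
∣p∩q∣+∣p∩∁q∣≡∣p∣ []            []            = refl
∣p∩q∣+∣p∩∁q∣≡∣p∣ (outside ∷ p) (_       ∷ q) = ∣p∩q∣+∣p∩∁q∣≡∣p∣ p q
∣p∩q∣+∣p∩∁q∣≡∣p∣ (inside  ∷ p) (inside  ∷ q) = cong suc (∣p∩q∣+∣p∩∁q∣≡∣p∣ p q)
∣p∩q∣+∣p∩∁q∣≡∣p∣ (inside  ∷ p) (outside ∷ q) = trans (+-suc _ _) (cong suc (∣p∩q∣+∣p∩∁q∣≡∣p∣ p q))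

∣p∪q∣+∣p∩q∣≡∣p∣+∣q∣ : ∀ {n} (p q : Subset n) → ∣ p ∪ q ∣ + ∣ p ∩ q ∣ ≡ ∣ p ∣ + ∣ q ∣
∣p∪q∣+∣p∩q∣≡∣p∣+∣q∣ []            []            = refl
∣p∪q∣+∣p∩q∣≡∣p∣+∣q∣ (outside ∷ p) (outside ∷ q) = ∣p∪q∣+∣p∩q∣≡∣p∣+∣q∣ p q
∣p∪q∣+∣p∩q∣≡∣p∣+∣q∣ (inside  ∷ p) (outside ∷ q) = cong suc (∣p∪q∣+∣p∩q∣≡∣p∣+∣q∣ p q)
∣p∪q∣+∣p∩q∣≡∣p∣+∣q∣ (outside ∷ p) (inside  ∷ q) =
  trans (cong suc (∣p∪q∣+∣p∩q∣≡∣p∣+∣q∣ p q)) (≡-sym (+-suc _ _))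
∣p∪q∣+∣p∩q∣≡∣p∣+∣q∣ (inside  ∷ p) (inside  ∷ q) =
  cong suc (trans (+-suc _ _) (trans (cong suc (∣p∪q∣+∣p∩q∣≡∣p∣+∣q∣ p q)) (≡-sym (+-suc _ _))))

∣p∪q∣≤∣p∣+∣q∣ : ∀ {n} (p q : Subset n) → ∣ p ∪ q ∣ ≤ ∣ p ∣ + ∣ q ∣
∣p∪q∣≤∣p∣+∣q∣ p q = subst (∣ p ∪ q ∣ ≤_) (∣p∪q∣+∣p∩q∣≡∣p∣+∣q∣ p q) (m≤m+n _ _)

disjoint⇒∣p∣+∣q∣≤∣p∪q∣ : ∀ {n} {p q : Subset n} → (∀ {x} → x ∈ p → x ∉ q) → ∣ p ∣ + ∣ q ∣ ≤ ∣ p ∪ q ∣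
disjoint⇒∣p∣+∣q∣≤∣p∪q∣ {n} {p} {q} disjoint = begin
  ∣ p ∣ + ∣ q ∣           ≡⟨ ≡-sym (∣p∪q∣+∣p∩q∣≡∣p∣+∣q∣ p q) ⟩
  ∣ p ∪ q ∣ + ∣ p ∩ q ∣   ≤⟨ +-monoʳ-≤ ∣ p ∪ q ∣ (p⊆q⇒∣p∣≤∣q∣ p∩q⊆∅) ⟩
  ∣ p ∪ q ∣ + ∣ ∅ {n} ∣   ≡⟨ cong (∣ p ∪ q ∣ +_) (∣⊥∣≡0 n) ⟩
  ∣ p ∪ q ∣ + 0           ≡⟨ +-identityʳ _ ⟩
  ∣ p ∪ q ∣               ∎
  where
  open ≤-Reasoning
  p∩q⊆∅ : p ∩ q ⊆ ∅
  p∩q⊆∅ x∈p∩q = ⊥-elim (disjoint (p∩q⊆p p q x∈p∩q) (p∩q⊆q p q x∈p∩q))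

∪-lub : ∀ {n} {p q r : Subset n} → p ⊆ r → q ⊆ r → p ∪ q ⊆ r
∪-lub {p = p} {q} p⊆r q⊆r x∈p∪q = [ p⊆r , q⊆r ] (x∈p∪q⁻ p q x∈p∪q)

p⊆q⇒∣q∣≤∣p∣⇒q⊆p : ∀ {n} {p q : Subset n} → p ⊆ q → ∣ q ∣ ≤ ∣ p ∣ → q ⊆ p
p⊆q⇒∣q∣≤∣p∣⇒q⊆p {p = p} p⊆q ∣q∣≤∣p∣ {x} x∈q with x ∈? p
... | yes x∈p = x∈p
... | no  x∉p = ⊥-elim (<⇒≱ (p⊂q⇒∣p∣<∣q∣ (p⊆q , x , x∈q , x∉p)) ∣q∣≤∣p∣)

Largest : ∀ {n} → (Subset n → Set) → Subset n → Set
Largest P S = P S × (∀ T → P T → ∣ T ∣ ≤ ∣ S ∣)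

largest-absorbs : ∀ {n} {P : Subset n → Set} {U A} → Largest P U → P (U ∪ A) → A ⊆ U
largest-absorbs {U = U} {A} (_ , largest) pU∪A =
  p⊆q⇒∣q∣≤∣p∣⇒q⊆p (p⊆p∪q A) (largest (U ∪ A) pU∪A) ∘ q⊆p∪q U A

module _ {n} {P : Subset n → Set} (P? : Decidable P) where

  private
    Exceeded : Subset n → Set
    Exceeded S = ∃ λ T → P T × ∣ S ∣ < ∣ T ∣

    exceeded? : Decidable Exceeded
    exceeded? S = anySubset? (λ T → P? T ×-dec ∣ S ∣ <? ∣ T ∣)

    unexceeded⇒largest : ∀ {S} → P S → ¬ Exceeded S → Largest P S
    unexceeded⇒largest pS ∄ = pS , λ T pT → ≮⇒≥ λ ∣S∣<∣T∣ → ∄ (T , pT , ∣S∣<∣T∣)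

  largest? : Decidable (Largest P)
  largest? S with P? S | exceeded? S
  ... | no ¬pS | _                      = no (¬pS ∘ proj₁)
  ... | yes _  | yes (T , pT , ∣S∣<∣T∣) = no λ (_ , largest) → <⇒≱ ∣S∣<∣T∣ (largest T pT)
  ... | yes pS | no ∄                   = yes (unexceeded⇒largest pS ∄)

  largest-exists : ∀ {S} → P S → ∃ (Largest P)
  largest-exists {S} pS = climb n S pS (λ T _ → ≤-trans (∣p∣≤n T) (m≤n+m n ∣ S ∣))
    where
    climb : ∀ k S → P S → (∀ T → P T → ∣ T ∣ ≤ ∣ S ∣ + k) → ∃ (Largest P)
    climb k S pS bound with exceeded? S
    ... | no ∄ = S , unexceeded⇒largest pS ∄
    climb zero S pS bound | yes (T , pT , ∣S∣<∣T∣) =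
      ⊥-elim (<⇒≱ ∣S∣<∣T∣ (subst (∣ T ∣ ≤_) (+-identityʳ ∣ S ∣) (bound T pT)))
    climb (suc k) S pS bound | yes (T , pT , ∣S∣<∣T∣) = climb k T pT λ U pU →
      ≤-trans (bound U pU) (subst (_≤ ∣ T ∣ + k) (≡-sym (+-suc ∣ S ∣ k)) (+-monoˡ-≤ k ∣S∣<∣T∣))

anyFin⁻ : ∀ {n} (f : Fin n → Bool) → anyFin f ≡ true → ∃ λ y → f y ≡ true
anyFin⁻ {suc n} f any-f with f zero in f0
... | true  = zero , f0
... | false = let (y , fy) = anyFin⁻ (f ∘ suc) any-f in suc y , fy

anyFin⁺ : ∀ {n} (f : Fin n → Bool) {y} → f y ≡ true → anyFin f ≡ true
anyFin⁺ {suc n} f {zero}  fy rewrite fy = refl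
anyFin⁺ {suc n} f {suc y} fy = trans (cong (f zero ∨_) (anyFin⁺ (f ∘ suc) fy)) (∨-zeroʳ (f zero))

∧-true⁻ : ∀ {a b} → a ∧ b ≡ true → a ≡ true × b ≡ true
∧-true⁻ {true} {true} refl = refl , refl

module _ {n} (G : Graph n) where

  adjacent-sym : ∀ {x y} → Adjacent G x y → Adjacent G y x
  adjacent-sym {x} {y} x~y = trans (sym G y x) x~y

  ∈-nbhd⁻ : ∀ {S x} → x ∈ nbhd G S → ∃ λ y → y ∈ S × Adjacent G x y
  ∈-nbhd⁻ {S} {x} x∈NS =
    let (y , y∈S∧x~y) = anyFin⁻ (λ y → lookup S y ∧ adj G x y)
                          (trans (≡-sym (lookup∘tabulate _ x)) ([]=⇒lookup x∈NS))
        (y∈S , x~y)   = ∧-true⁻ {lookup S y} y∈S∧x~y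
    in y , lookup⇒[]= y S y∈S , x~y

  ∈-nbhd⁺ : ∀ {S x y} → y ∈ S → Adjacent G x y → x ∈ nbhd G S
  ∈-nbhd⁺ {S} {x} {y} y∈S x~y = lookup⇒[]= x (nbhd G S) (trans (lookup∘tabulate _ x)
    (anyFin⁺ (λ z → lookup S z ∧ adj G x z)
      (subst (λ b → b ∧ adj G x y ≡ true) (≡-sym ([]=⇒lookup y∈S)) x~y)))

  nbhd-mono : ∀ {S S′} → S ⊆ S′ → nbhd G S ⊆ nbhd G S′
  nbhd-mono S⊆S′ x∈NS = let (y , y∈S , x~y) = ∈-nbhd⁻ x∈NS in ∈-nbhd⁺ (S⊆S′ y∈S) x~y

  independent? : Decidable (Independent G)
  independent? S = all? λ x → all? λ y → x ∈? S →-dec (y ∈? S →-dec ¬? (adj G x y ≟ᵇ true))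

  independentIn? : ∀ W → Decidable (IndepIn G W)
  independentIn? W S = S ⊆? W ×-dec independent? S

  maxIndepIn? : ∀ W → Decidable (MaxIndepIn G W)
  maxIndepIn? W = largest? (independentIn? W)

  inCorona? : ∀ W → Decidable (InCorona G W)
  inCorona? W x = anySubset? λ S → maxIndepIn? W S ×-dec x ∈? S

  inCore-or-avoided : ∀ W y → InCore G W y ⊎ ∃ λ S → MaxIndepIn G W S × y ∉ S
  inCore-or-avoided W y with anySubset? (λ S → maxIndepIn? W S ×-dec ¬? (y ∈? S))
  ... | yes avoided = inj₂ avoided
  ... | no ∄        = inj₁ λ S max → decidable-stable (y ∈? S) λ y∉S → ∄ (S , max , y∉S)

  inCore? : ∀ W → Decidable (InCore G W)
  inCore? W y with inCore-or-avoided W y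
  ... | inj₁ core             = yes core
  ... | inj₂ (S , max , y∉S) = no λ core → y∉S (core S max)

  covered⇒coronaNCoreDecomp : ∀ {W} → (∀ {x} → x ∈ W → InCorona G W x ⊎ InNbrIn G W (InCore G W) x) →
    CoronaNCoreDecomp G W
  covered⇒coronaNCoreDecomp {W} covered = (λ x → mk⇔ covered inside-W) , corona-disjoint
    where
    inside-W : ∀ {x} → InCorona G W x ⊎ InNbrIn G W (InCore G W) x → x ∈ W
    inside-W (inj₁ (S , ((S⊆W , _) , _) , x∈S)) = S⊆W x∈S
    inside-W (inj₂ (x∈W , _))                   = x∈W
    corona-disjoint : ∀ x → InCorona G W x → InNbrIn G W (InCore G W) x → ⊥
    corona-disjoint x (S , max , x∈S) (_ , y , _ , core , x~y) = proj₂ (proj₁ max) x y x∈S (core S max) x~y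

module CriticalIndependentSet {n} (G : Graph n) {J : Subset n} (critical : CriticalIndep G J) where

  private
    N : Subset n → Subset n
    N = nbhd G

  W : Subset n
  W = ∁ (J ∪ N J)

  ∈W⇒∉J : ∀ {x} → x ∈ W → x ∉ J
  ∈W⇒∉J x∈W x∈J = x∈∁p⇒x∉p x∈W (x∈p∪q⁺ (inj₁ x∈J))

  ∈W⇒∉NJ : ∀ {x} → x ∈ W → x ∉ N J
  ∈W⇒∉NJ x∈W x∈NJ = x∈∁p⇒x∉p x∈W (x∈p∪q⁺ (inj₂ x∈NJ))

  ∉J∧∉NJ⇒∈W : ∀ {x} → x ∉ J → x ∉ N J → x ∈ W
  ∉J∧∉NJ⇒∈W x∉J x∉NJ = x∉p⇒x∈∁p λ x∈J∪NJ → [ x∉J , x∉NJ ] (x∈p∪q⁻ J (N J) x∈J∪NJ)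

  trichotomy : ∀ x → x ∈ J ⊎ x ∈ N J ⊎ x ∈ W
  trichotomy x with x ∈? J | x ∈? N J
  ... | yes x∈J | _        = inj₁ x∈J
  ... | no _    | yes x∈NJ = inj₂ (inj₁ x∈NJ)
  ... | no x∉J  | no x∉NJ  = inj₂ (inj₂ (∉J∧∉NJ⇒∈W x∉J x∉NJ))

  ∈J⇒∉NJ : ∀ {x} → x ∈ J → x ∉ N J
  ∈J⇒∉NJ {x} x∈J x∈NJ = let (y , y∈J , x~y) = ∈-nbhd⁻ G x∈NJ in proj₁ critical x y x∈J y∈J x~y

  ∣K∣+∣NJ∣≤∣J∣+∣NK∣ : ∀ K → ∣ K ∣ + ∣ N J ∣ ≤ ∣ J ∣ + ∣ N K ∣
  ∣K∣+∣NJ∣≤∣J∣+∣NK∣ K = m-n≤o-p⇒m+p≤o+n (∣ K ∣) (∣ N K ∣) (∣ J ∣) (∣ N J ∣) (proj₂ critical K)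

  hall : ∀ {A} → A ⊆ N J → ∣ A ∣ ≤ ∣ J ∩ N A ∣
  hall {A} A⊆NJ = +-cancelʳ-≤ (∣ K ∣ + ∣ N K ∣) ∣ A ∣ ∣ J ∩ N A ∣ (begin
    ∣ A ∣ + (∣ K ∣ + ∣ N K ∣)        ≡⟨ +-comm ∣ A ∣ _ ⟩
    ∣ K ∣ + ∣ N K ∣ + ∣ A ∣          ≡⟨ +-assoc ∣ K ∣ _ _ ⟩
    ∣ K ∣ + (∣ N K ∣ + ∣ A ∣)        ≤⟨ +-monoʳ-≤ ∣ K ∣ ∣NK∣+∣A∣≤∣NJ∣ ⟩
    ∣ K ∣ + ∣ N J ∣                  ≤⟨ ∣K∣+∣NJ∣≤∣J∣+∣NK∣ K ⟩
    ∣ J ∣ + ∣ N K ∣                  ≡⟨ cong (_+ ∣ N K ∣) (≡-sym (∣p∩q∣+∣p∩∁q∣≡∣p∣ J (N A))) ⟩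
    ∣ J ∩ N A ∣ + ∣ K ∣ + ∣ N K ∣    ≡⟨ +-assoc ∣ J ∩ N A ∣ _ _ ⟩
    ∣ J ∩ N A ∣ + (∣ K ∣ + ∣ N K ∣)  ∎)
    where
    open ≤-Reasoning
    K : Subset n
    K = J ∩ ∁ (N A)
    NK-disjoint-A : ∀ {y} → y ∈ N K → y ∉ A
    NK-disjoint-A y∈NK y∈A =
      let (k , k∈K , y~k) = ∈-nbhd⁻ G y∈NK
      in x∈∁p⇒x∉p (p∩q⊆q J _ k∈K) (∈-nbhd⁺ G y∈A (adjacent-sym G y~k))
    ∣NK∣+∣A∣≤∣NJ∣ : ∣ N K ∣ + ∣ A ∣ ≤ ∣ N J ∣
    ∣NK∣+∣A∣≤∣NJ∣ = ≤-trans (disjoint⇒∣p∣+∣q∣≤∣p∪q∣ NK-disjoint-A)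
                            (p⊆q⇒∣p∣≤∣q∣ (∪-lub (nbhd-mono G (p∩q⊆p J _)) A⊆NJ))

  Tight : Subset n → Set
  Tight A = A ⊆ N J × ∣ J ∩ N A ∣ ≤ ∣ A ∣

  tight? : Decidable Tight
  tight? A = A ⊆? N J ×-dec ∣ J ∩ N A ∣ ≤? ∣ A ∣

  ∅-tight : Tight ∅
  ∅-tight = ⊥⊆ , p⊆q⇒∣p∣≤∣q∣ {q = ∅} λ y∈J∩N∅ →
    let (_ , z∈∅ , _) = ∈-nbhd⁻ G (p∩q⊆q J _ y∈J∩N∅) in ⊥-elim (∉⊥ z∈∅)

  tight-∪ : ∀ {A B} → Tight A → Tight B → Tight (A ∪ B)
  tight-∪ {A} {B} (A⊆NJ , A-tight) (B⊆NJ , B-tight) =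
    ∪-lub A⊆NJ B⊆NJ , +-cancelʳ-≤ ∣ X ∩ Y ∣ _ _ (begin
      ∣ J ∩ N (A ∪ B) ∣ + ∣ X ∩ Y ∣  ≤⟨ +-monoˡ-≤ _ (p⊆q⇒∣p∣≤∣q∣ J∩N[A∪B]⊆X∪Y) ⟩
      ∣ X ∪ Y ∣ + ∣ X ∩ Y ∣          ≡⟨ ∣p∪q∣+∣p∩q∣≡∣p∣+∣q∣ X Y ⟩
      ∣ X ∣ + ∣ Y ∣                  ≤⟨ +-mono-≤ A-tight B-tight ⟩
      ∣ A ∣ + ∣ B ∣                  ≡⟨ ≡-sym (∣p∪q∣+∣p∩q∣≡∣p∣+∣q∣ A B) ⟩
      ∣ A ∪ B ∣ + ∣ A ∩ B ∣          ≤⟨ +-monoʳ-≤ _ (hall (λ z∈A∩B → A⊆NJ (p∩q⊆p A B z∈A∩B))) ⟩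
      ∣ A ∪ B ∣ + ∣ J ∩ N (A ∩ B) ∣  ≤⟨ +-monoʳ-≤ _ (p⊆q⇒∣p∣≤∣q∣ J∩N[A∩B]⊆X∩Y) ⟩
      ∣ A ∪ B ∣ + ∣ X ∩ Y ∣          ∎)
    where
    open ≤-Reasoning
    X Y : Subset n
    X = J ∩ N A
    Y = J ∩ N B
    J∩N[A∪B]⊆X∪Y : J ∩ N (A ∪ B) ⊆ X ∪ Y
    J∩N[A∪B]⊆X∪Y y∈ with x∈p∩q⁻ J _ y∈
    ... | y∈J , y∈N[A∪B] with ∈-nbhd⁻ G y∈N[A∪B]
    ... | z , z∈A∪B , y~z with x∈p∪q⁻ A B z∈A∪B
    ... | inj₁ z∈A = x∈p∪q⁺ (inj₁ (x∈p∩q⁺ (y∈J , ∈-nbhd⁺ G z∈A y~z)))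
    ... | inj₂ z∈B = x∈p∪q⁺ (inj₂ (x∈p∩q⁺ (y∈J , ∈-nbhd⁺ G z∈B y~z)))
    J∩N[A∩B]⊆X∩Y : J ∩ N (A ∩ B) ⊆ X ∩ Y
    J∩N[A∩B]⊆X∩Y y∈ =
      let (y∈J , y∈N[A∩B]) = x∈p∩q⁻ J _ y∈
      in x∈p∩q⁺ ( x∈p∩q⁺ (y∈J , nbhd-mono G (p∩q⊆p A B) y∈N[A∩B])
                , x∈p∩q⁺ (y∈J , nbhd-mono G (p∩q⊆q A B) y∈N[A∩B]))

  S∩J⊆J∩∁N[S∩NJ] : ∀ {S} → Independent G S → S ∩ J ⊆ J ∩ ∁ (N (S ∩ N J))
  S∩J⊆J∩∁N[S∩NJ] {S} S-independent {x} x∈S∩J =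
    let (x∈S , x∈J) = x∈p∩q⁻ S J x∈S∩J
    in x∈p∩q⁺ (x∈J , x∉p⇒x∈∁p λ x∈N[S∩NJ] →
         let (y , y∈S∩NJ , x~y) = ∈-nbhd⁻ G x∈N[S∩NJ]
         in S-independent x y x∈S (p∩q⊆p S _ y∈S∩NJ) x~y)

  ∣S∩NJ∣+∣S∩J∣≤∣J∣ : ∀ {S} → Independent G S → ∣ S ∩ N J ∣ + ∣ S ∩ J ∣ ≤ ∣ J ∣
  ∣S∩NJ∣+∣S∩J∣≤∣J∣ {S} S-independent = begin
    ∣ A ∣ + ∣ S ∩ J ∣              ≤⟨ +-mono-≤ (hall (p∩q⊆q S (N J)))
                                               (p⊆q⇒∣p∣≤∣q∣ (S∩J⊆J∩∁N[S∩NJ] S-independent)) ⟩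
    ∣ J ∩ N A ∣ + ∣ J ∩ ∁ (N A) ∣  ≡⟨ ∣p∩q∣+∣p∩∁q∣≡∣p∣ J (N A) ⟩
    ∣ J ∣                          ∎
    where
    open ≤-Reasoning
    A : Subset n
    A = S ∩ N J

  ∣S∣≤∣S∩NJ∣+∣S∩J∣+∣S∩W∣ : ∀ S → ∣ S ∣ ≤ ∣ S ∩ N J ∣ + ∣ S ∩ J ∣ + ∣ S ∩ W ∣
  ∣S∣≤∣S∩NJ∣+∣S∩J∣+∣S∩W∣ S = begin
    ∣ S ∣                                ≡⟨ ≡-sym (∣p∩q∣+∣p∩∁q∣≡∣p∣ S (J ∪ N J)) ⟩
    ∣ S ∩ (J ∪ N J) ∣ + ∣ S ∩ W ∣        ≡⟨ cong (λ X → ∣ X ∣ + ∣ S ∩ W ∣) (∩-distribˡ-∪ S J (N J)) ⟩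
    ∣ S ∩ J ∪ S ∩ N J ∣ + ∣ S ∩ W ∣      ≤⟨ +-monoˡ-≤ _ (∣p∪q∣≤∣p∣+∣q∣ (S ∩ J) (S ∩ N J)) ⟩
    ∣ S ∩ J ∣ + ∣ S ∩ N J ∣ + ∣ S ∩ W ∣  ≡⟨ cong (_+ ∣ S ∩ W ∣) (+-comm (∣ S ∩ J ∣) _) ⟩
    ∣ S ∩ N J ∣ + ∣ S ∩ J ∣ + ∣ S ∩ W ∣  ∎
    where open ≤-Reasoning

  ∣S∣≤∣J∣+∣S∩W∣ : ∀ {S} → Independent G S → ∣ S ∣ ≤ ∣ J ∣ + ∣ S ∩ W ∣
  ∣S∣≤∣J∣+∣S∩W∣ {S} S-independent =
    ≤-trans (∣S∣≤∣S∩NJ∣+∣S∩J∣+∣S∩W∣ S) (+-monoˡ-≤ _ (∣S∩NJ∣+∣S∩J∣≤∣J∣ S-independent))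

  J∪-independent : ∀ {T} → IndepIn G W T → Independent G (J ∪ T)
  J∪-independent {T} (T⊆W , T-independent) x y x∈J∪T y∈J∪T x~y
    with x∈p∪q⁻ J T x∈J∪T | x∈p∪q⁻ J T y∈J∪T
  ... | inj₁ x∈J | inj₁ y∈J = proj₁ critical x y x∈J y∈J x~y
  ... | inj₂ x∈T | inj₂ y∈T = T-independent x y x∈T y∈T x~y
  ... | inj₁ x∈J | inj₂ y∈T = ∈W⇒∉NJ (T⊆W y∈T) (∈-nbhd⁺ G x∈J (adjacent-sym G x~y))
  ... | inj₂ x∈T | inj₁ y∈J = ∈W⇒∉NJ (T⊆W x∈T) (∈-nbhd⁺ G y∈J x~y)

  ∣J∣+∣T∣≤∣J∪T∣ : ∀ {T} → T ⊆ W → ∣ J ∣ + ∣ T ∣ ≤ ∣ J ∪ T ∣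
  ∣J∣+∣T∣≤∣J∪T∣ T⊆W = disjoint⇒∣p∣+∣q∣≤∣p∪q∣ λ x∈J x∈T → ∈W⇒∉J (T⊆W x∈T) x∈J

  ∩W-independentIn : ∀ {S} → Independent G S → IndepIn G W (S ∩ W)
  ∩W-independentIn {S} S-independent =
    p∩q⊆q S W , λ x y x∈ y∈ → S-independent x y (p∩q⊆p S W x∈) (p∩q⊆p S W y∈)

  ∣J∣+∣T∣≤∣S∣ : ∀ {S T} → MaxIndepIn G ⊤ S → IndepIn G W T → ∣ J ∣ + ∣ T ∣ ≤ ∣ S ∣
  ∣J∣+∣T∣≤∣S∣ (_ , largest) T-independentIn =
    ≤-trans (∣J∣+∣T∣≤∣J∪T∣ (proj₁ T-independentIn)) (largest _ ((λ _ → ∈⊤) , J∪-independent T-independentIn))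

  J∪-maxIndep : ∀ {T} → MaxIndepIn G W T → MaxIndepIn G ⊤ (J ∪ T)
  J∪-maxIndep {T} (T-independentIn , largest) = ((λ _ → ∈⊤) , J∪-independent T-independentIn) ,
    λ S (_ , S-independent) → begin
      ∣ S ∣              ≤⟨ ∣S∣≤∣J∣+∣S∩W∣ S-independent ⟩
      ∣ J ∣ + ∣ S ∩ W ∣  ≤⟨ +-monoʳ-≤ ∣ J ∣ (largest _ (∩W-independentIn S-independent)) ⟩
      ∣ J ∣ + ∣ T ∣      ≤⟨ ∣J∣+∣T∣≤∣J∪T∣ (proj₁ T-independentIn) ⟩
      ∣ J ∪ T ∣          ∎
    where open ≤-Reasoning

  ∩W-maxIndep : ∀ {S} → MaxIndepIn G ⊤ S → MaxIndepIn G W (S ∩ W)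
  ∩W-maxIndep {S} S-max@((_ , S-independent) , _) = ∩W-independentIn S-independent ,
    λ T T-independentIn → +-cancelˡ-≤ ∣ J ∣ _ _
      (≤-trans (∣J∣+∣T∣≤∣S∣ S-max T-independentIn) (∣S∣≤∣J∣+∣S∩W∣ S-independent))

  maxIndepW : ∃ (MaxIndepIn G W)
  maxIndepW = largest-exists (independentIn? G W) {∅} (⊥⊆ , λ _ _ x∈∅ → ⊥-elim (∉⊥ x∈∅))

  J⊆corona : ∀ {x} → x ∈ J → InCorona G ⊤ x
  J⊆corona x∈J = let (T , T-max) = maxIndepW in J ∪ T , J∪-maxIndep T-max , x∈p∪q⁺ (inj₁ x∈J)

  corona-extend : ∀ {x} → InCorona G W x → InCorona G ⊤ x
  corona-extend (T , T-max , x∈T) = J ∪ T , J∪-maxIndep T-max , x∈p∪q⁺ (inj₂ x∈T)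

  corona-restrict : ∀ {x} → InCorona G ⊤ x → x ∈ W → InCorona G W x
  corona-restrict (S , S-max , x∈S) x∈W = S ∩ W , ∩W-maxIndep S-max , x∈p∩q⁺ (x∈S , x∈W)

  core-extend : ∀ {y} → InCore G W y → InCore G ⊤ y
  core-extend {y} y∈core S S-max = p∩q⊆p S W (y∈core (S ∩ W) (∩W-maxIndep S-max))

  core-restrict : ∀ {y} → InCore G ⊤ y → y ∈ W → InCore G W y
  core-restrict y∈core y∈W T T-max =
    [ (λ y∈J → ⊥-elim (∈W⇒∉J y∈W y∈J)) , id ] (x∈p∪q⁻ J T (y∈core (J ∪ T) (J∪-maxIndep T-max)))

  core-disjoint-NJ : ∀ {y} → InCore G ⊤ y → y ∉ N J
  core-disjoint-NJ y∈core y∈NJ with maxIndepW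
  ... | T , T-max = [ (λ y∈J → ∈J⇒∉NJ y∈J y∈NJ) , (λ y∈T → ∈W⇒∉NJ (proj₁ (proj₁ T-max) y∈T) y∈NJ) ]
                      (x∈p∪q⁻ J T (y∈core (J ∪ T) (J∪-maxIndep T-max)))

  module _ {S} (S-max : MaxIndepIn G ⊤ S) where

    -- |J| ≤ |A| + |S ∩ J| ≤ |J ∩ N A| + |J ∩ ∁ N A| = |J| with a termwise middle step, so both
    -- |A| ≤ |J ∩ N A| and |S ∩ J| ≤ |J ∩ ∁ N A| are equalities.
    private
      A : Subset n
      A = S ∩ N J

      S-independent : Independent G S
      S-independent = proj₂ (proj₁ S-max)

      ∣J∣≤∣A∣+∣S∩J∣ : ∣ J ∣ ≤ ∣ A ∣ + ∣ S ∩ J ∣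
      ∣J∣≤∣A∣+∣S∩J∣ = +-cancelʳ-≤ ∣ S ∩ W ∣ _ _
        (≤-trans (∣J∣+∣T∣≤∣S∣ S-max (∩W-independentIn S-independent)) (∣S∣≤∣S∩NJ∣+∣S∩J∣+∣S∩W∣ S))

      S∩J⊆J∩∁NA : S ∩ J ⊆ J ∩ ∁ (N A)
      S∩J⊆J∩∁NA = S∩J⊆J∩∁N[S∩NJ] S-independent

      ∣J∩NA∣+∣J∩∁NA∣≤∣A∣+∣S∩J∣ : ∣ J ∩ N A ∣ + ∣ J ∩ ∁ (N A) ∣ ≤ ∣ A ∣ + ∣ S ∩ J ∣
      ∣J∩NA∣+∣J∩∁NA∣≤∣A∣+∣S∩J∣ =
        subst (_≤ ∣ A ∣ + ∣ S ∩ J ∣) (≡-sym (∣p∩q∣+∣p∩∁q∣≡∣p∣ J (N A))) ∣J∣≤∣A∣+∣S∩J∣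

    maxIndep⇒tight : Tight (S ∩ N J)
    maxIndep⇒tight = p∩q⊆q S (N J) , +-cancelʳ-≤ ∣ J ∩ ∁ (N A) ∣ _ _
      (≤-trans ∣J∩NA∣+∣J∩∁NA∣≤∣A∣+∣S∩J∣ (+-monoʳ-≤ ∣ A ∣ (p⊆q⇒∣p∣≤∣q∣ S∩J⊆J∩∁NA)))

    maxIndep-dominates : ∀ {y} → y ∈ J → y ∉ S → y ∈ N (S ∩ N J)
    maxIndep-dominates {y} y∈J y∉S = decidable-stable (y ∈? N A) λ y∉NA →
      y∉S (p∩q⊆p S J (J∩∁NA⊆S∩J (x∈p∩q⁺ (y∈J , x∉p⇒x∈∁p y∉NA))))
      where
      J∩∁NA⊆S∩J : J ∩ ∁ (N A) ⊆ S ∩ J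
      J∩∁NA⊆S∩J = p⊆q⇒∣q∣≤∣p∣⇒q⊆p S∩J⊆J∩∁NA (+-cancelˡ-≤ ∣ J ∩ N A ∣ _ _
        (≤-trans ∣J∩NA∣+∣J∩∁NA∣≤∣A∣+∣S∩J∣ (+-monoˡ-≤ ∣ S ∩ J ∣ (hall (p∩q⊆q S (N J))))))

  J-neighbours-avoided⇒⊥ : ∀ {x} → x ∈ N J → ¬ InCorona G ⊤ x →
    (∀ {y} → y ∈ J → Adjacent G x y → ∃ λ S → MaxIndepIn G ⊤ S × y ∉ S) → ⊥
  J-neighbours-avoided⇒⊥ {x} x∈NJ x∉corona avoided = <⇒≱ ∣U∣<∣V∣ (begin
    ∣ V ∣        ≤⟨ hall V⊆NJ ⟩
    ∣ J ∩ N V ∣  ≤⟨ p⊆q⇒∣p∣≤∣q∣ J∩NV⊆J∩NU ⟩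
    ∣ J ∩ N U ∣  ≤⟨ proj₂ U-tight ⟩
    ∣ U ∣        ∎)
    where
    open ≤-Reasoning
    TightAvoiding : Subset n → Set
    TightAvoiding U = Tight U × x ∉ U

    largestTightAvoiding : ∃ (Largest TightAvoiding)
    largestTightAvoiding = largest-exists (λ U → tight? U ×-dec ¬? (x ∈? U)) (∅-tight , ∉⊥)

    U : Subset n
    U = proj₁ largestTightAvoiding

    U-largest : Largest TightAvoiding U
    U-largest = proj₂ largestTightAvoiding

    U-tight : Tight U
    U-tight = proj₁ (proj₁ U-largest)

    x∉U : x ∉ U
    x∉U = proj₂ (proj₁ U-largest)

    V : Subset n
    V = U ∪ ⁅ x ⁆

    dominated : ∀ {y} → y ∈ J → Adjacent G x y → y ∈ N U
    dominated y∈J x~y with avoided y∈J x~y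
    ... | S , S-max , y∉S = nbhd-mono G S∩NJ⊆U (maxIndep-dominates S-max y∈J y∉S)
      where
      x∉U∪[S∩NJ] : x ∉ U ∪ S ∩ N J
      x∉U∪[S∩NJ] x∈ = [ x∉U , (λ x∈S∩NJ → x∉corona (S , S-max , p∩q⊆p S (N J) x∈S∩NJ)) ]
                        (x∈p∪q⁻ U (S ∩ N J) x∈)
      S∩NJ⊆U : S ∩ N J ⊆ U
      S∩NJ⊆U = largest-absorbs U-largest (tight-∪ U-tight (maxIndep⇒tight S-max) , x∉U∪[S∩NJ])

    V⊆NJ : V ⊆ N J
    V⊆NJ = ∪-lub (proj₁ U-tight) λ z∈⁅x⁆ → subst (_∈ N J) (≡-sym (x∈⁅y⁆⇒x≡y x z∈⁅x⁆)) x∈NJ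

    J∩NV⊆J∩NU : J ∩ N V ⊆ J ∩ N U
    J∩NV⊆J∩NU z∈ with x∈p∩q⁻ J _ z∈
    ... | z∈J , z∈NV with ∈-nbhd⁻ G z∈NV
    ... | v , v∈V , z~v with x∈p∪q⁻ U ⁅ x ⁆ v∈V
    ... | inj₁ v∈U  = x∈p∩q⁺ (z∈J , ∈-nbhd⁺ G v∈U z~v)
    ... | inj₂ v∈⁅x⁆ rewrite x∈⁅y⁆⇒x≡y x v∈⁅x⁆ = x∈p∩q⁺ (z∈J , dominated z∈J (adjacent-sym G z~v))

    ∣U∣<∣V∣ : ∣ U ∣ < ∣ V ∣
    ∣U∣<∣V∣ = p⊂q⇒∣p∣<∣q∣ (p⊆p∪q ⁅ x ⁆ , x , q⊆p∪q U ⁅ x ⁆ (x∈⁅x⁆ x) , x∉U)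

  NJ⊆corona∪N[core] : ∀ {x} → x ∈ N J → InCorona G ⊤ x ⊎ InNbrIn G ⊤ (InCore G ⊤) x
  NJ⊆corona∪N[core] {x} x∈NJ with inCorona? G ⊤ x
  ... | yes x∈corona = inj₁ x∈corona
  ... | no x∉corona with any? (λ y → adj G x y ≟ᵇ true ×-dec inCore? G ⊤ y)
  ...   | yes (y , x~y , y∈core) = inj₂ (∈⊤ , y , ∈⊤ , y∈core , x~y)
  ...   | no ∄ = ⊥-elim (J-neighbours-avoided⇒⊥ x∈NJ x∉corona avoided)
    where
    avoided : ∀ {y} → y ∈ J → Adjacent G x y → ∃ λ S → MaxIndepIn G ⊤ S × y ∉ S
    avoided {y} _ x~y with inCore-or-avoided G ⊤ y
    ... | inj₁ y∈core = ⊥-elim (∄ (y , x~y , y∈core))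
    ... | inj₂ y-avoided = y-avoided

  restrict-cover : CoronaNCoreDecomp G ⊤ → ∀ {x} → x ∈ W → InCorona G W x ⊎ InNbrIn G W (InCore G W) x
  restrict-cover (cover , _) {x} x∈W with Equivalence.to (cover x) ∈⊤
  ... | inj₁ x∈corona = inj₁ (corona-restrict x∈corona x∈W)
  ... | inj₂ (_ , y , _ , y∈core , x~y) = inj₂ (x∈W , y , y∈W , core-restrict y∈core y∈W , x~y)
    where
    y∈W : y ∈ W
    y∈W = ∉J∧∉NJ⇒∈W (λ y∈J → ∈W⇒∉NJ x∈W (∈-nbhd⁺ G y∈J x~y)) (core-disjoint-NJ y∈core)

  extend-cover : CoronaNCoreDecomp G W → ∀ {x} → x ∈ ⊤ → InCorona G ⊤ x ⊎ InNbrIn G ⊤ (InCore G ⊤) x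
  extend-cover (cover , _) {x} _ with trichotomy x
  ... | inj₁ x∈J         = inj₁ (J⊆corona x∈J)
  ... | inj₂ (inj₁ x∈NJ) = NJ⊆corona∪N[core] x∈NJ
  ... | inj₂ (inj₂ x∈W) with Equivalence.to (cover x) x∈W
  ...   | inj₁ x∈corona                   = inj₁ (corona-extend x∈corona)
  ...   | inj₂ (_ , y , _ , y∈core , x~y) = inj₂ (∈⊤ , y , ∈⊤ , core-extend y∈core , x~y)

mainTheorem8 : ∀ {n} (G : Graph n) (J : Subset n) → MaxCriticalIndep G J →
    (CoronaNCoreDecomp G ⊤ ⇔ CoronaNCoreDecomp G (∁ (J ∪ nbhd G J)))
mainTheorem8 G J (critical , _) = mk⇔
  (λ decomp → covered⇒coronaNCoreDecomp G (restrict-cover decomp))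
  (λ decomp → covered⇒coronaNCoreDecomp G (extend-cover decomp))
  where open CriticalIndependentSet G critical
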